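{- Let $\lambda/\mu$ be a skew shape with $r$ rows and $c$ columns, $n=r+c$, and let $(I_1,\dots,I_n)$ be the Grassmann necklace of its rook matroid $\mathcal{R}_{\lambda/\mu}$. (a) If $i\in[2,r]$ is a row index, then $(i,c_i+1)$ is an outer corner of $\lambda/\mu$ if and only if $c_i<c_{i-1}$. (b) If $i\in[r+2,r+c-1]$ is a column index, then $(r_i-1,i-1)$ is an inner corner of $\lambda/\mu$ if and only if $r_i>r_{i+1}$. Moreover, in either case, if the equivalent conditions hold then $I_i$ is not a cyclic interval of $[n]$.
   Context: Rows of $\lambda/\mu$ are labelled $1,\dots,r$ top to bottom, columns $r+1,\dots,r+c$ left to right; the skew shape is the cell set $\{(i,r+j):1\le i\le r,\ \mu_i<j\le\lambda_i\}$, all rows and columns nonempty. Inner corner: a cell $(i,j)\notin\lambda/\mu$ with $(i+1,j),(i,j+1)\in\lambda/\mu$; outer corner: a cell $(i,j)\notin\lambda/\mu$ with $(i,j-1),(i-1,j)\in\lambda/\mu$. The rook matroid $\mathcal{R}_{\lambda/\mu}$ is the matroid on $[n]$ with bases $R(\rho)\cup C(\rho)$ ($R$ = occupied rows, $C$ = unoccupied columns) over all non-nesting rook placements $\rho$ (no two rooks in a common row or column, no two $(i,j),(k,\ell)$ with $i<k$, $j<\ell$). Its Grassmann necklace: $I_i$ is the lexicographically smallest basis with respect to the order $i<i+1<\dots<n<1<\dots<i-1$; equivalently $I_i=R(\rho_i)\cup C(\rho_i)$ where $\rho_i$ is the $i$-extremal non-nesting rook placement (for a row $i$: rook in the last cell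 of row $i$, then in rows $i+1,\dots,r$ successively place rooks as far right as possible keeping non-nesting, until reaching the last row or first column; for a column $i$: leave columns $i,\dots,r+c$ empty and in rows $1,\dots,r$ successively place rooks as far right as possible keeping those columns empty and the placement non-attacking, non-nesting). Notation: $R_i=I_i\cap[1,r]$, $r_i=\min R_i$ (for $i\neq r+1$), $r_i=0$ for $i\ge n+1$; $C_i=I_i\cap[r+1,n]$, $c_i=\max([r+1,n]\setminus C_i)$. Cyclic interval: $\{a,\dots,b\}$ or $\{a,\dots,n,1,\dots,b\}$. -}

module Defs where

open import Data.Nat using (ℕ; zero; suc; _+_; _∸_; _≤_; _<_; _≤ᵇ_)
open import Data.Bool using (Bool; true; false; if_then_else_; _∧_; not)
open import Data.Product using (Σ; ∃; _×_; _,_; proj₁; proj₂)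
open import Data.Sum using (_⊎_)
open import Data.List using (List)
open import Data.List.Relation.Unary.All using (All)
open import Data.List.Relation.Unary.Any using (Any)
open import Data.List.Relation.Unary.AllPairs using (AllPairs)
open import Relation.Nullary using (¬_)
open import Relation.Binary.PropositionalEquality using (_≡_; _≢_)
open import Function.Bundles using (_⇔_)

-- A skew shape λ/μ with r rows and c columns.  λ and μ are read on the
-- row indices 1..r (values elsewhere are irrelevant).  Row i of λ/μ
-- consists of the cells (i , r + j) with μ i < j ≤ λ i.
record SkewShape : Set where
  field
    r c : ℕ
    lam mu : ℕ → ℕ
    lam-dec : ∀ i → 1 ≤ i → i < r → lam (suc i) ≤ lam i
    mu-dec  : ∀ i → 1 ≤ i → i < r → mu (suc i) ≤ mu i
    lam-le-c : ∀ i → 1 ≤ i → i ≤ r → lam i ≤ c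
    row-nonempty : ∀ i → 1 ≤ i → i ≤ r → mu i < lam i
    col-nonempty : ∀ j → 1 ≤ j → j ≤ c →
                   ∃ λ i → 1 ≤ i × i ≤ r × mu i < j × j ≤ lam i

module _ (S : SkewShape) where
  open SkewShape S

  size : ℕ
  size = r + c

  InShape : ℕ → ℕ → Set
  InShape i j = 1 ≤ i × i ≤ r × r + mu i < j × j ≤ r + lam i

  InnerCorner : ℕ → ℕ → Set
  InnerCorner i j = ¬ InShape i j × InShape (suc i) j × InShape i (suc j)

  -- outer corner: (i,j) ∉ λ/μ, (i,j-1) ∈ λ/μ, (i-1,j) ∈ λ/μ
  -- (truncated subtraction is harmless: row/column 0 contains no cell)
  OuterCorner : ℕ → ℕ → Set
  OuterCorner i j = ¬ InShape i j × InShape i (j ∸ 1) × InShape (i ∸ 1) j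

  Cell : Set
  Cell = ℕ × ℕ

  Compatible : Cell → Cell → Set
  Compatible (i , j) (k , l) =
    i ≢ k × j ≢ l × ¬ (i < k × j < l) × ¬ (k < i × l < j)

  NonNestingPlacement : List Cell → Set
  NonNestingPlacement ρ = All (λ x → InShape (proj₁ x) (proj₂ x)) ρ × AllPairs Compatible ρ

  InRC : List Cell → ℕ → Set
  InRC ρ x = Any (λ y → proj₁ y ≡ x) ρ
           ⊎ (suc r ≤ x × x ≤ size × ¬ Any (λ y → proj₂ y ≡ x) ρ)

  -- subsets of [n] are Boolean membership functions, read on 1..n
  Subset : Set
  Subset = ℕ → Bool

  IsBasis : Subset → Set
  IsBasis B = ∃ λ ρ → NonNestingPlacement ρ ×
              (∀ x → 1 ≤ x → x ≤ size → (B x ≡ true ⇔ InRC ρ x))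

  -- position of x in the cyclic order i < i+1 < … < n < 1 < … < i-1
  key : ℕ → ℕ → ℕ
  key i x = if i ≤ᵇ x then x ∸ i else (x + size) ∸ i

  LexLeq : ℕ → Subset → Subset → Set
  LexLeq i A B =
      (∀ x → 1 ≤ x → x ≤ size → A x ≡ B x)
    ⊎ (∃ λ p → 1 ≤ p × p ≤ size × A p ≡ true × B p ≡ false ×
         (∀ q → 1 ≤ q → q ≤ size → key i q < key i p → A q ≡ B q))

  IsNecklaceEntry : ℕ → Subset → Set
  IsNecklaceEntry i I = IsBasis I × (∀ B → IsBasis B → LexLeq i I B)

  IsCyclicInterval : Subset → Set
  IsCyclicInterval B = ∃ λ a → ∃ λ b → 1 ≤ a × a ≤ size × b ≤ size ×
    (∀ x → 1 ≤ x → x ≤ size →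
       (B x ≡ true ⇔ ((a ≤ x × x ≤ b) ⊎ (b < a × (a ≤ x ⊎ x ≤ b)))))

-- least x ≥ lo among the next `fuel` numbers with B x = true (0 if none)
firstTrue : (ℕ → Bool) → ℕ → ℕ → ℕ
firstTrue B x zero = 0
firstTrue B x (suc f) = if B x then x else firstTrue B (suc x) f

-- min (B ∩ [lo,hi]), 0 if empty
minIn : (ℕ → Bool) → ℕ → ℕ → ℕ
minIn B lo hi = firstTrue B lo (suc hi ∸ lo)

-- max ([lo,hi] ∖ B), 0 if empty
maxNotIn : (ℕ → Bool) → ℕ → ℕ → ℕ
maxNotIn B lo zero = 0
maxNotIn B lo (suc h) =
  if (lo ≤ᵇ suc h) ∧ not (B (suc h)) then suc h else maxNotIn B lo h

module _ (S : SkewShape) (I : ℕ → ℕ → Bool) where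
  open SkewShape S

  -- r_i = min R_i where R_i = I_i ∩ [1,r];  r_i = 0 for i ≥ n+1
  rowMin : ℕ → ℕ
  rowMin i = if suc (r + c) ≤ᵇ i then 0 else minIn (I i) 1 r

  colMax : ℕ → ℕ
  colMax i = maxNotIn (I i) (suc r) (r + c)

-- Minimality of I_i is used only in one form: a basis B cannot gain an element p ∉ I_i
-- before I_i gains anything over B (in the order i < i+1 < … < n < 1 < …).  Testing I_i
-- against explicit placements (a single rook, the empty placement, or the rooks of its own
-- placement in rows ≥ i, possibly with the rook of row i moved to the end of its row)
-- shows: for a row i, row i ∈ I_i, rows before i ∉ I_i, the rook of row i sits in the last
-- cell r + λ_i of its row and all later columns are free, so c_i = r + λ_i; for a column
-- i, columns i,…,n ∈ I_i and r_i is the first row whose leftmost cell lies left of column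
-- i.  The corner conditions then become λ_i < λ_{i-1}, resp. r_{i+1} < r_i, via column
-- nonemptiness and monotonicity of λ and μ; and I_i shows the pattern ∉ ∈ ∉ ∈ at i-1, i,
-- r+λ_i, r+λ_i+1 (resp. at r_i - 1, r_i, the column of the rook in row r_i, i), which no
-- cyclic interval contains.

module Submission where

open import Defs
open import Data.Nat using (ℕ; zero; suc; _+_; _∸_; _≤_; _<_; _≤ᵇ_; _≤′_; ≤′-refl; ≤′-step; z≤n; s≤s)
open import Data.Nat.Properties
open import Data.Bool using (Bool; true; false)
open import Data.Bool.Properties using (∧-zeroʳ; T-≡)
open import Data.Product using (∃; _×_; _,_; proj₁; proj₂)
open import Data.Sum using (_⊎_; inj₁; inj₂)
open import Data.Empty using (⊥; ⊥-elim)
open import Data.List using (List; []; _∷_; filter)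
open import Data.List.Relation.Unary.All as All using (All; []; _∷_)
open import Data.List.Relation.Unary.Any using (here; there; any?)
open import Data.List.Relation.Unary.AllPairs using (AllPairs; []; _∷_)
import Data.List.Relation.Unary.All.Properties as All
import Data.List.Relation.Unary.AllPairs.Properties as AllPairs
open import Data.List.Membership.Propositional using (_∈_; find; lose)
open import Data.List.Membership.Propositional.Properties using (∈-filter⁺; ∈-filter⁻)
open import Relation.Nullary using (¬_; Dec; yes; no; does; contradiction)
open import Relation.Nullary.Reflects using (ofʸ; ofⁿ)
open import Relation.Nullary.Decidable using (_×-dec_; _⊎-dec_; ¬?)
open import Relation.Binary.PropositionalEquality using (_≡_; _≢_; refl; sym; trans; subst; subst₂)
open import Relation.Binary using (Symmetric; tri<; tri≈; tri>)
open import Function.Bundles using (_⇔_; mk⇔; Equivalence)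

open Equivalence using (to; from)

≡true⇒≢false : ∀ {b : Bool} → b ≡ true → b ≢ false
≡true⇒≢false refl ()

≢true⇒≡false : ∀ {b : Bool} → b ≢ true → b ≡ false
≢true⇒≡false {false} _ = refl
≢true⇒≡false {true} b≢true = contradiction refl b≢true

≢false⇒≡true : ∀ {b : Bool} → b ≢ false → b ≡ true
≢false⇒≡true {false} b≢false = contradiction refl b≢false
≢false⇒≡true {true} _ = refl

does-⇔ : ∀ {P : Set} (P? : Dec P) → (does P? ≡ true ⇔ P)
does-⇔ (yes p) = mk⇔ (λ _ → p) (λ _ → refl)
does-⇔ (no ¬p) = mk⇔ (λ ()) (λ p → contradiction p ¬p)

maxNotIn-≡ : ∀ (B : ℕ → Bool) lo h m → lo ≤ m → m ≤ h → B m ≡ false →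
  (∀ x → m < x → x ≤ h → B x ≡ true) → maxNotIn B lo h ≡ m
maxNotIn-≡ B lo zero m lo≤m m≤0 Bm above = sym (n≤0⇒n≡0 m≤0)
maxNotIn-≡ B lo (suc h) m lo≤m m≤h Bm above with ≤⇒≤′ m≤h
... | ≤′-refl rewrite to T-≡ (≤⇒≤ᵇ lo≤m) | Bm = refl
... | ≤′-step m≤′h rewrite above (suc h) (s≤s (≤′⇒≤ m≤′h)) ≤-refl | ∧-zeroʳ (lo ≤ᵇ suc h) =
  maxNotIn-≡ B lo h m lo≤m (≤′⇒≤ m≤′h) Bm (λ x m<x x≤h → above x m<x (m≤n⇒m≤1+n x≤h))

FalseOn : (ℕ → Bool) → ℕ → ℕ → Set
FalseOn B lo hi = ∀ y → lo ≤ y → y < hi → B y ≡ false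

FalseOn-extend : ∀ {B lo hi} → B lo ≡ false → FalseOn B (suc lo) hi → FalseOn B lo hi
FalseOn-extend Blo rest y lo≤y y<hi with m≤n⇒m<n∨m≡n lo≤y
... | inj₁ lo<y = rest y lo<y y<hi
... | inj₂ refl = Blo

firstTrue-spec : ∀ (B : ℕ → Bool) lo f → FalseOn B lo (lo + f) ⊎
  (lo ≤ firstTrue B lo f × firstTrue B lo f < lo + f × B (firstTrue B lo f) ≡ true × FalseOn B lo (firstTrue B lo f))
firstTrue-spec B lo zero = inj₁ λ y lo≤y y<lo+0 → contradiction (subst (y <_) (+-identityʳ lo) y<lo+0) (≤⇒≯ lo≤y)
firstTrue-spec B lo (suc f) with B lo in Blo
... | true = inj₂ (≤-refl , m<m+n lo (s≤s z≤n) , Blo , λ y lo≤y y<lo → contradiction y<lo (≤⇒≯ lo≤y))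
... | false with firstTrue-spec B (suc lo) f
...   | inj₁ none = inj₁ (FalseOn-extend Blo (subst (FalseOn B (suc lo)) (sym (+-suc lo f)) none))
...   | inj₂ (lo<m , m<hi , Bm , below) =
  inj₂ (<⇒≤ lo<m , subst (firstTrue B (suc lo) f <_) (sym (+-suc lo f)) m<hi , Bm , FalseOn-extend Blo below)

allPairs-lookup : ∀ {A : Set} {R : A → A → Set} → Symmetric R → ∀ {xs x y} →
  AllPairs R xs → x ∈ xs → y ∈ xs → x ≡ y ⊎ R x y
allPairs-lookup sym-R (_ ∷ _) (here refl) (here refl) = inj₁ refl
allPairs-lookup sym-R (Rx ∷ _) (here refl) (there y∈) = inj₂ (All.lookup Rx y∈)
allPairs-lookup sym-R (Rx ∷ _) (there x∈) (here refl) = inj₂ (sym-R (All.lookup Rx x∈))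
allPairs-lookup sym-R (_ ∷ Rxs) (there x∈) (there y∈) = allPairs-lookup sym-R Rxs x∈ y∈

antitone-by-steps : ∀ (r : ℕ) (f : ℕ → ℕ) → (∀ k → 1 ≤ k → k < r → f (suc k) ≤ f k) →
  ∀ {a b} → 1 ≤ a → a ≤ b → b ≤ r → f b ≤ f a
antitone-by-steps r f step {a} 1≤a a≤b = go (≤⇒≤′ a≤b)
  where
  go : ∀ {b} → a ≤′ b → b ≤ r → f b ≤ f a
  go ≤′-refl _ = ≤-refl
  go (≤′-step a≤′b) b<r = ≤-trans (step _ (≤-trans 1≤a (≤′⇒≤ a≤′b)) b<r) (go a≤′b (<⇒≤ b<r))

module _ (S : SkewShape) where
  open SkewShape S

  lam-antitone : ∀ {a b} → 1 ≤ a → a ≤ b → b ≤ r → lam b ≤ lam a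
  lam-antitone = antitone-by-steps r lam lam-dec

  mu-antitone : ∀ {a b} → 1 ≤ a → a ≤ b → b ≤ r → mu b ≤ mu a
  mu-antitone = antitone-by-steps r mu mu-dec

  cell-column-bounds : ∀ {k x} → InShape S k x → r < x × x ≤ r + c
  cell-column-bounds {k} (1≤k , k≤r , first<x , x≤last) =
    ≤-<-trans (m≤m+n r (mu k)) first<x , ≤-trans x≤last (+-monoʳ-≤ r (lam-le-c k 1≤k k≤r))

  firstCell : ∀ {k} → 1 ≤ k → k ≤ r → InShape S k (suc (r + mu k))
  firstCell {k} 1≤k k≤r = 1≤k , k≤r , ≤-refl , +-monoʳ-< r (row-nonempty k 1≤k k≤r)

  lastCell : ∀ {k} → 1 ≤ k → k ≤ r → InShape S k (r + lam k)
  lastCell {k} 1≤k k≤r = 1≤k , k≤r , +-monoʳ-< r (row-nonempty k 1≤k k≤r) , ≤-refl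

  column-has-cell : ∀ {x} → r < x → x ≤ r + c → ∃ λ k → InShape S k x
  column-has-cell {x} r<x x≤n with col-nonempty (x ∸ r) (m<n⇒0<n∸m r<x) j≤c
    where
    j≤c : x ∸ r ≤ c
    j≤c = subst (x ∸ r ≤_) (m+n∸m≡n r c) (∸-monoˡ-≤ r x≤n)
  ... | k , 1≤k , k≤r , mu<j , j≤lam =
    k , 1≤k , k≤r , subst (r + mu k <_) r+j≡x (+-monoʳ-< r mu<j) , subst (_≤ r + lam k) r+j≡x (+-monoʳ-≤ r j≤lam)
    where
    r+j≡x : r + (x ∸ r) ≡ x
    r+j≡x = m+[n∸m]≡n (<⇒≤ r<x)

  InCell : ℕ × ℕ → Set
  InCell y = InShape S (proj₁ y) (proj₂ y)

  IsBasisOf : List (ℕ × ℕ) → Subset S → Set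
  IsBasisOf ρ B = All InCell ρ × (∀ x → 1 ≤ x → x ≤ r + c → (B x ≡ true ⇔ InRC S ρ x))

  module BasisOf {ρ : List (ℕ × ℕ)} {B : Subset S} (ρ-B : IsBasisOf ρ B) where

    inCell : ∀ {y} → y ∈ ρ → InCell y
    inCell = All.lookup (proj₁ ρ-B)

    member : ∀ {x} → 1 ≤ x → x ≤ r + c → (B x ≡ true ⇔ InRC S ρ x)
    member = proj₂ ρ-B _

    row∈ : ∀ {y} → y ∈ ρ → B (proj₁ y) ≡ true
    row∈ y∈ with inCell y∈
    ... | 1≤k , k≤r , _ = from (member 1≤k (≤-trans k≤r (m≤m+n r c))) (inj₁ (lose y∈ refl))

    row∈⁻ : ∀ {x} → 1 ≤ x → x ≤ r → B x ≡ true → ∃ λ y → y ∈ ρ × proj₁ y ≡ x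
    row∈⁻ 1≤x x≤r Bx with to (member 1≤x (≤-trans x≤r (m≤m+n r c))) Bx
    ... | inj₁ occupied = find occupied
    ... | inj₂ (r<x , _) = contradiction x≤r (<⇒≱ r<x)

    row∉ : ∀ {x} → 1 ≤ x → x ≤ r → (∀ {y} → y ∈ ρ → proj₁ y ≢ x) → B x ≡ false
    row∉ 1≤x x≤r empty = ≢true⇒≡false λ Bx → let (y , y∈ , e) = row∈⁻ 1≤x x≤r Bx in empty y∈ e

    col∉ : ∀ {y} → y ∈ ρ → B (proj₂ y) ≡ false
    col∉ {y} y∈ = ≢true⇒≡false λ By → excluded (to (member 1≤x x≤n) By)
      where
      r<x : r < proj₂ y
      r<x = proj₁ (cell-column-bounds (inCell y∈))
      x≤n : proj₂ y ≤ r + c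
      x≤n = proj₂ (cell-column-bounds (inCell y∈))
      1≤x : 1 ≤ proj₂ y
      1≤x = ≤-trans (s≤s z≤n) r<x
      excluded : ¬ InRC S ρ (proj₂ y)
      excluded (inj₁ occupied) with find occupied
      ... | z , z∈ , e = <⇒≱ r<x (subst (_≤ r) e (proj₁ (proj₂ (inCell z∈))))
      excluded (inj₂ (_ , _ , free)) = free (lose y∈ refl)

    col∈ : ∀ {x} → r < x → x ≤ r + c → (∀ {y} → y ∈ ρ → proj₂ y ≢ x) → B x ≡ true
    col∈ r<x x≤n free = from (member (≤-trans (s≤s z≤n) r<x) x≤n)
      (inj₂ (r<x , x≤n , λ occupied → let (y , y∈ , e) = find occupied in free y∈ e))

    col∈⁻ : ∀ {x y} → B x ≡ true → y ∈ ρ → proj₂ y ≢ x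
    col∈⁻ Bx y∈ refl = ≡true⇒≢false Bx (col∉ y∈)

  inRC? : (ρ : List (ℕ × ℕ)) (x : ℕ) → Dec (InRC S ρ x)
  inRC? ρ x = any? (λ y → proj₁ y ≟ x) ρ
    ⊎-dec (suc r ≤? x ×-dec x ≤? r + c ×-dec ¬? (any? (λ y → proj₂ y ≟ x) ρ))

  basisOf : List (ℕ × ℕ) → Subset S
  basisOf ρ x = does (inRC? ρ x)

  basisOf-isBasisOf : ∀ {ρ} → All InCell ρ → IsBasisOf ρ (basisOf ρ)
  basisOf-isBasisOf ρ⊆λ/μ = ρ⊆λ/μ , λ x _ _ → does-⇔ (inRC? _ x)

  basisOf-isBasis : ∀ {ρ} → NonNestingPlacement S ρ → IsBasis S (basisOf ρ)
  basisOf-isBasis {ρ} ρ-nn = ρ , ρ-nn , λ x _ _ → does-⇔ (inRC? ρ x)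

  Compatible-sym : Symmetric (Compatible S)
  Compatible-sym (i≢k , j≢l , ¬nest , ¬nest′) = (λ e → i≢k (sym e)) , (λ e → j≢l (sym e)) , ¬nest′ , ¬nest

  filter-nonNesting : ∀ {P : ℕ × ℕ → Set} (P? : ∀ y → Dec (P y)) {ρ} →
    NonNestingPlacement S ρ → NonNestingPlacement S (filter P? ρ)
  filter-nonNesting P? (ρ⊆λ/μ , ρ-compat) = All.filter⁺ P? ρ⊆λ/μ , AllPairs.filter⁺ P? ρ-compat

  module NonNesting {ρ : List (ℕ × ℕ)} (ρ-nn : NonNestingPlacement S ρ) where

    compatible : ∀ {x y} → x ∈ ρ → y ∈ ρ → x ≡ y ⊎ Compatible S x y
    compatible = allPairs-lookup Compatible-sym (proj₂ ρ-nn)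

    row-unique : ∀ {x y} → x ∈ ρ → y ∈ ρ → proj₁ x ≡ proj₁ y → x ≡ y
    row-unique x∈ y∈ e with compatible x∈ y∈
    ... | inj₁ x≡y = x≡y
    ... | inj₂ (i≢k , _) = contradiction e i≢k

    column-unique : ∀ {x y} → x ∈ ρ → y ∈ ρ → proj₂ x ≡ proj₂ y → x ≡ y
    column-unique x∈ y∈ e with compatible x∈ y∈
    ... | inj₁ x≡y = x≡y
    ... | inj₂ (_ , j≢l , _) = contradiction e j≢l

    row<⇒column> : ∀ {x y} → x ∈ ρ → y ∈ ρ → proj₁ x < proj₁ y → proj₂ y < proj₂ x
    row<⇒column> {x} {y} x∈ y∈ i<k with compatible x∈ y∈
    ... | inj₁ refl = contradiction i<k (<-irrefl refl)
    ... | inj₂ (_ , j≢l , ¬nest , _) with <-cmp (proj₂ x) (proj₂ y)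
    ...   | tri< j<l _ _ = contradiction (i<k , j<l) ¬nest
    ...   | tri≈ _ j≡l _ = contradiction j≡l j≢l
    ...   | tri> _ _ l<j = l<j

  module CyclicOrder {i : ℕ} (i≤n : i ≤ r + c) where

    key-≥ : ∀ {x} → i ≤ x → key S i x + i ≡ x
    key-≥ {x} i≤x with i ≤ᵇ x | ≤ᵇ-reflects-≤ i x
    ... | true | _ = m∸n+n≡m i≤x
    ... | false | ofⁿ i≰x = contradiction i≤x i≰x

    key-< : ∀ {x} → x < i → key S i x + i ≡ x + (r + c)
    key-< {x} x<i with i ≤ᵇ x | ≤ᵇ-reflects-≤ i x
    ... | true | ofʸ i≤x = contradiction i≤x (<⇒≱ x<i)
    ... | false | _ = m∸n+n≡m (≤-trans i≤n (m≤n+m (r + c) x))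

    key-mono-≥ : ∀ {p q} → i ≤ p → p < q → key S i p < key S i q
    key-mono-≥ i≤p p<q = +-cancelʳ-< i _ _
      (subst₂ _<_ (sym (key-≥ i≤p)) (sym (key-≥ (≤-trans i≤p (<⇒≤ p<q)))) p<q)

    key-mono-< : ∀ {p q} → p < q → q < i → key S i p < key S i q
    key-mono-< p<q q<i = +-cancelʳ-< i _ _
      (subst₂ _<_ (sym (key-< (<-trans p<q q<i))) (sym (key-< q<i)) (+-monoˡ-< (r + c) p<q))

    key-wrap : ∀ {p q} → 1 ≤ q → q < i → i ≤ p → p ≤ r + c → key S i p < key S i q
    key-wrap 1≤q q<i i≤p p≤n = +-cancelʳ-< i _ _
      (subst₂ _<_ (sym (key-≥ i≤p)) (sym (key-< q<i)) (≤-trans (s≤s p≤n) (+-monoˡ-≤ (r + c) 1≤q)))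

  necklaceEntry-minimal : ∀ {i J B} → IsNecklaceEntry S i J → IsBasis S B →
    ∀ {p} → 1 ≤ p → p ≤ r + c → J p ≡ false → B p ≡ true →
    (∀ q → 1 ≤ q → q ≤ r + c → J q ≡ true → B q ≡ false → key S i p < key S i q) → ⊥
  necklaceEntry-minimal (_ , J-min) B-basis {p} 1≤p p≤n Jp Bp J-gains-later with J-min _ B-basis
  ... | inj₁ J≗B = ≡true⇒≢false Bp (trans (sym (J≗B p 1≤p p≤n)) Jp)
  ... | inj₂ (q , 1≤q , q≤n , Jq , Bq , agree) =
    ≡true⇒≢false Bp (trans (sym (agree p 1≤p p≤n (J-gains-later q 1≤q q≤n Jq Bq))) Jp)

  module NecklaceEntry (i : ℕ) {J : Subset S} (J-entry : IsNecklaceEntry S i J) where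

    ρ : List (ℕ × ℕ)
    ρ = proj₁ (proj₁ J-entry)

    ρ-nn : NonNestingPlacement S ρ
    ρ-nn = proj₁ (proj₂ (proj₁ J-entry))

    ρ-J : IsBasisOf ρ J
    ρ-J = proj₁ ρ-nn , proj₂ (proj₂ (proj₁ J-entry))

    open BasisOf ρ-J public
    open NonNesting ρ-nn public


  module RowEntry {i : ℕ} (1≤i : 1 ≤ i) (i≤r : i ≤ r) {J : Subset S} (J-entry : IsNecklaceEntry S i J) where
    open NecklaceEntry i J-entry

    i≤n : i ≤ r + c
    i≤n = ≤-trans i≤r (m≤m+n r c)

    open CyclicOrder i≤n

    L : ℕ
    L = r + lam i

    r<L : r < L
    r<L = proj₁ (cell-column-bounds (lastCell 1≤i i≤r))

    L≤n : L ≤ r + c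
    L≤n = proj₂ (cell-column-bounds (lastCell 1≤i i≤r))

    row-i∈ : J i ≡ true
    row-i∈ = ≢false⇒≡true λ Ji →
      necklaceEntry-minimal {i} J-entry (basisOf-isBasis σ-nn) 1≤i i≤n Ji (σ.row∈ (here refl)) (i-first Ji)
      where
      σ-nn : NonNestingPlacement S ((i , L) ∷ [])
      σ-nn = (lastCell 1≤i i≤r ∷ []) , ([] ∷ [])
      module σ = BasisOf (basisOf-isBasisOf (proj₁ σ-nn))
      i-first : J i ≡ false → ∀ q → 1 ≤ q → q ≤ r + c → J q ≡ true → basisOf ((i , L) ∷ []) q ≡ false →
        key S i i < key S i q
      i-first Ji q 1≤q q≤n Jq _ with <-cmp i q
      ... | tri< i<q _ _ = key-mono-≥ ≤-refl i<q
      ... | tri≈ _ refl _ = ⊥-elim (≡true⇒≢false Jq Ji)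
      ... | tri> _ _ q<i = key-wrap 1≤q q<i ≤-refl i≤n

    rook-row≥i : ∀ {y} → y ∈ ρ → i ≤ proj₁ y
    rook-row≥i {y} y∈ with i ≤? proj₁ y
    ... | yes i≤k = i≤k
    ... | no i≰k = ⊥-elim
      (necklaceEntry-minimal {i} J-entry (basisOf-isBasis σ-nn) 1≤l l≤n (col∉ y∈) (σ.col∈ r<l l≤n l-free) l-first)
      where
      σ : List (ℕ × ℕ)
      σ = filter (λ z → i ≤? proj₁ z) ρ
      σ-nn : NonNestingPlacement S σ
      σ-nn = filter-nonNesting (λ z → i ≤? proj₁ z) ρ-nn
      module σ = BasisOf (basisOf-isBasisOf (proj₁ σ-nn))
      σ⊆ρ : ∀ {z} → z ∈ σ → z ∈ ρ × i ≤ proj₁ z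
      σ⊆ρ = ∈-filter⁻ (λ z → i ≤? proj₁ z) {xs = ρ}
      r<l : r < proj₂ y
      r<l = proj₁ (cell-column-bounds (inCell y∈))
      l≤n : proj₂ y ≤ r + c
      l≤n = proj₂ (cell-column-bounds (inCell y∈))
      1≤l : 1 ≤ proj₂ y
      1≤l = ≤-trans (s≤s z≤n) r<l
      l-free : ∀ {z} → z ∈ σ → proj₂ z ≢ proj₂ y
      l-free z∈σ e with column-unique (proj₁ (σ⊆ρ z∈σ)) y∈ e
      ... | refl = i≰k (proj₂ (σ⊆ρ z∈σ))
      l-first : ∀ q → 1 ≤ q → q ≤ r + c → J q ≡ true → basisOf σ q ≡ false → key S i (proj₂ y) < key S i q
      l-first q 1≤q q≤n Jq σq with q ≤? r | i ≤? q
      ... | no q≰r | _ = ⊥-elim (≡true⇒≢false (σ.col∈ (≰⇒> q≰r) q≤n (λ z∈σ → col∈⁻ Jq (proj₁ (σ⊆ρ z∈σ)))) σq)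
      ... | yes _ | no i≰q = key-wrap 1≤q (≰⇒> i≰q) (≤-trans i≤r (<⇒≤ r<l)) l≤n
      ... | yes q≤r | yes i≤q with row∈⁻ 1≤q q≤r Jq
      ...   | z , z∈ , refl = ⊥-elim (≡true⇒≢false (σ.row∈ (∈-filter⁺ (λ z → i ≤? proj₁ z) z∈ i≤q)) σq)

    rook-i : ∃ λ y → y ∈ ρ × proj₁ y ≡ i
    rook-i = row∈⁻ 1≤i i≤r row-i∈

    y₀ : ℕ × ℕ
    y₀ = proj₁ rook-i

    y₀∈ : y₀ ∈ ρ
    y₀∈ = proj₁ (proj₂ rook-i)

    y₀-row : proj₁ y₀ ≡ i
    y₀-row = proj₂ (proj₂ rook-i)

    rook-i-last : proj₂ y₀ ≡ L
    rook-i-last with m≤n⇒m<n∨m≡n j≤L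
      where
      j≤L : proj₂ y₀ ≤ L
      j≤L = subst (λ k → proj₂ y₀ ≤ r + lam k) y₀-row (proj₂ (proj₂ (proj₂ (inCell y₀∈))))
    ... | inj₂ j≡L = j≡L
    ... | inj₁ j<L = ⊥-elim
      (necklaceEntry-minimal {i} J-entry (basisOf-isBasis σ-nn) 1≤j j≤n (col∉ y₀∈) (σ.col∈ r<j j≤n j-free) j-first)
      where
      j : ℕ
      j = proj₂ y₀
      r<j : r < j
      r<j = proj₁ (cell-column-bounds (inCell y₀∈))
      j≤n : j ≤ r + c
      j≤n = proj₂ (cell-column-bounds (inCell y₀∈))
      1≤j : 1 ≤ j
      1≤j = ≤-trans (s≤s z≤n) r<j
      below : List (ℕ × ℕ)
      below = filter (λ z → i <? proj₁ z) ρ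
      below-nn : NonNestingPlacement S below
      below-nn = filter-nonNesting (λ z → i <? proj₁ z) ρ-nn
      below⊆ρ : ∀ {z} → z ∈ below → z ∈ ρ × i < proj₁ z
      below⊆ρ = ∈-filter⁻ (λ z → i <? proj₁ z) {xs = ρ}
      below-left : ∀ {z} → z ∈ below → proj₂ z < j
      below-left z∈ = row<⇒column> y₀∈ (proj₁ (below⊆ρ z∈)) (subst (_< _) (sym y₀-row) (proj₂ (below⊆ρ z∈)))
      last-compatible : ∀ {z} → z ∈ below → Compatible S (i , L) z
      last-compatible {z} z∈ =
        (λ e → <-irrefl e i<k) , (λ e → <-irrefl (sym e) l<L) , (λ nest → <-asym l<L (proj₂ nest)) , (λ nest → <-asym i<k (proj₁ nest))
        where
        i<k : i < proj₁ z
        i<k = proj₂ (below⊆ρ z∈)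
        l<L : proj₂ z < L
        l<L = <-trans (below-left z∈) j<L
      σ : List (ℕ × ℕ)
      σ = (i , L) ∷ below
      σ-nn : NonNestingPlacement S σ
      σ-nn = (lastCell 1≤i i≤r ∷ proj₁ below-nn) , (All.tabulate last-compatible ∷ proj₂ below-nn)
      module σ = BasisOf (basisOf-isBasisOf (proj₁ σ-nn))
      j-free : ∀ {z} → z ∈ σ → proj₂ z ≢ j
      j-free (here refl) e = <-irrefl (sym e) j<L
      j-free (there z∈) e = <-irrefl e (below-left z∈)
      j-first : ∀ q → 1 ≤ q → q ≤ r + c → J q ≡ true → basisOf σ q ≡ false → key S i j < key S i q
      j-first q 1≤q q≤n Jq σq with q ≤? r
      ... | yes q≤r = ⊥-elim (≡true⇒≢false (rows-kept (row∈⁻ 1≤q q≤r Jq)) σq)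
        where
        rows-kept : (∃ λ z → z ∈ ρ × proj₁ z ≡ q) → basisOf σ q ≡ true
        rows-kept (z , z∈ , refl) with i <? proj₁ z
        ... | yes i<k = σ.row∈ (there (∈-filter⁺ (λ z → i <? proj₁ z) z∈ i<k))
        ... | no i≮k = subst (λ k → basisOf σ k ≡ true) (≤-antisym (rook-row≥i z∈) (≮⇒≥ i≮k)) (σ.row∈ (here refl))
      ... | no q≰r with q ≟ L
      ...   | yes refl = key-mono-≥ (≤-trans i≤r (<⇒≤ r<j)) j<L
      ...   | no q≢L = ⊥-elim (≡true⇒≢false (σ.col∈ (≰⇒> q≰r) q≤n q-free) σq)
        where
        q-free : ∀ {z} → z ∈ σ → proj₂ z ≢ q
        q-free (here refl) e = q≢L (sym e)
        q-free (there z∈) = col∈⁻ Jq (proj₁ (below⊆ρ z∈))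

    column-L∉ : J L ≡ false
    column-L∉ = subst (λ x → J x ≡ false) rook-i-last (col∉ y₀∈)

    columns-after-L∈ : ∀ x → L < x → x ≤ r + c → J x ≡ true
    columns-after-L∈ x L<x x≤n = col∈ (<-trans r<L L<x) x≤n x-free
      where
      x-free : ∀ {z} → z ∈ ρ → proj₂ z ≢ x
      x-free {z} z∈ e with m≤n⇒m<n∨m≡n (rook-row≥i z∈)
      ... | inj₁ i<k = <-asym L<x (subst₂ _<_ e rook-i-last (row<⇒column> y₀∈ z∈ (subst (_< _) (sym y₀-row) i<k)))
      ... | inj₂ i≡k with row-unique z∈ y₀∈ (trans (sym i≡k) (sym y₀-row))
      ...   | refl = <-irrefl (trans (sym rook-i-last) e) L<x

    rows-before-i∉ : ∀ k → 1 ≤ k → k < i → J k ≡ false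
    rows-before-i∉ k 1≤k k<i = row∉ 1≤k (≤-trans (<⇒≤ k<i) i≤r) (λ z∈ e → <⇒≱ k<i (subst (i ≤_) e (rook-row≥i z∈)))

    colMax-row : maxNotIn J (suc r) (r + c) ≡ L
    colMax-row = maxNotIn-≡ J (suc r) (r + c) L r<L L≤n column-L∉ columns-after-L∈

  StartsBefore : ℕ → ℕ → Set
  StartsBefore i k = suc (r + mu k) < i

  cell⇒startsBefore : ∀ {i k x} → InShape S k x → x < i → StartsBefore i k
  cell⇒startsBefore (_ , _ , first<x , _) x<i = ≤-<-trans first<x x<i

  IsFirstRowStartingBefore : ℕ → ℕ → Set
  IsFirstRowStartingBefore i m =
    1 ≤ m × m ≤ r × StartsBefore i m × (∀ k → 1 ≤ k → k < m → ¬ StartsBefore i k)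

  module ColumnEntry {i : ℕ} (r+2≤i : suc (suc r) ≤ i) (i≤n : i ≤ r + c) {J : Subset S} (J-entry : IsNecklaceEntry S i J) where
    open NecklaceEntry i J-entry
    open CyclicOrder i≤n

    r<i : r < i
    r<i = ≤-trans (n≤1+n (suc r)) r+2≤i

    columns-from-i∈ : ∀ x → i ≤ x → x ≤ r + c → J x ≡ true
    columns-from-i∈ x i≤x x≤n = ≢false⇒≡true λ Jx →
      necklaceEntry-minimal {i} J-entry (basisOf-isBasis ([] , [])) (≤-trans (s≤s z≤n) r<x) x≤n Jx (∅.col∈ r<x x≤n λ ()) x-first
      where
      r<x : r < x
      r<x = <-≤-trans r<i i≤x
      module ∅ = BasisOf (basisOf-isBasisOf {[]} [])
      x-first : ∀ q → 1 ≤ q → q ≤ r + c → J q ≡ true → basisOf [] q ≡ false → key S i x < key S i q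
      x-first q 1≤q q≤n Jq ∅q with q ≤? r
      ... | yes q≤r = key-wrap 1≤q (≤-<-trans q≤r r<i) i≤x x≤n
      ... | no q≰r = ⊥-elim (≡true⇒≢false (∅.col∈ (≰⇒> q≰r) q≤n λ ()) ∅q)

    rook-column<i : ∀ {y} → y ∈ ρ → proj₂ y < i
    rook-column<i y∈ = ≰⇒> λ i≤l →
      ≡true⇒≢false (columns-from-i∈ _ i≤l (proj₂ (cell-column-bounds (inCell y∈)))) (col∉ y∈)

    rook-startsBefore : ∀ {y} → y ∈ ρ → StartsBefore i (proj₁ y)
    rook-startsBefore y∈ = cell⇒startsBefore (inCell y∈) (rook-column<i y∈)

    first-startingBefore∈ : ∀ k → 1 ≤ k → k ≤ r → StartsBefore i k → FalseOn J 1 k → J k ≡ true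
    first-startingBefore∈ k 1≤k k≤r k-starts rows-before = ≢false⇒≡true λ Jk →
      necklaceEntry-minimal {i} J-entry (basisOf-isBasis σ-nn) 1≤k (≤-trans k≤r (m≤m+n r c)) Jk (σ.row∈ (here refl)) (k-first Jk)
      where
      σ-nn : NonNestingPlacement S ((k , suc (r + mu k)) ∷ [])
      σ-nn = (firstCell 1≤k k≤r ∷ []) , ([] ∷ [])
      module σ = BasisOf (basisOf-isBasisOf (proj₁ σ-nn))
      k-first : J k ≡ false → ∀ q → 1 ≤ q → q ≤ r + c → J q ≡ true → basisOf ((k , suc (r + mu k)) ∷ []) q ≡ false →
        key S i k < key S i q
      k-first Jk q 1≤q q≤n Jq σq with q <? i
      ... | no q≮i = ⊥-elim (≡true⇒≢false (σ.col∈ (<-≤-trans r<i (≮⇒≥ q≮i)) q≤n q-free) σq)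
        where
        q-free : ∀ {z} → z ∈ (k , suc (r + mu k)) ∷ [] → proj₂ z ≢ q
        q-free (here refl) e = q≮i (subst (_< i) e k-starts)
      ... | yes q<i with <-cmp k q
      ...   | tri< k<q _ _ = key-mono-< k<q q<i
      ...   | tri≈ _ refl _ = ⊥-elim (≡true⇒≢false Jq Jk)
      ...   | tri> _ _ q<k = ⊥-elim (≡true⇒≢false Jq (rows-before q 1≤q q<k))

    some-row-startsBefore : ∃ λ k → 1 ≤ k × k ≤ r × StartsBefore i k
    some-row-startsBefore with column-has-cell (n<1+n r) (≤-trans (n≤1+n (suc r)) (≤-trans r+2≤i i≤n))
    ... | k , cell = k , proj₁ cell , proj₁ (proj₂ cell) , cell⇒startsBefore cell r+2≤i

    m : ℕ
    m = minIn J 1 r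

    m-spec : 1 ≤ m × m ≤ r × J m ≡ true × FalseOn J 1 m
    m-spec with firstTrue-spec J 1 r
    ... | inj₂ (1≤m , m<1+r , Jm , rows-before) = 1≤m , ≤-pred m<1+r , Jm , rows-before
    ... | inj₁ none with some-row-startsBefore
    ...   | k , 1≤k , k≤r , k-starts = ⊥-elim (≡true⇒≢false
      (first-startingBefore∈ k 1≤k k≤r k-starts (λ y 1≤y y<k → none y 1≤y (<-trans y<k (s≤s k≤r))))
      (none k 1≤k (s≤s k≤r)))

    1≤m : 1 ≤ m
    1≤m = proj₁ m-spec

    m≤r : m ≤ r
    m≤r = proj₁ (proj₂ m-spec)

    row-m∈ : J m ≡ true
    row-m∈ = proj₁ (proj₂ (proj₂ m-spec))

    rows-before-m∉ : FalseOn J 1 m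
    rows-before-m∉ = proj₂ (proj₂ (proj₂ m-spec))

    rook-m : ∃ λ y → y ∈ ρ × proj₁ y ≡ m
    rook-m = row∈⁻ 1≤m m≤r row-m∈

    m-first : IsFirstRowStartingBefore i m
    m-first = 1≤m , m≤r , subst (StartsBefore i) (proj₂ (proj₂ rook-m)) (rook-startsBefore (proj₁ (proj₂ rook-m))) ,
      λ k 1≤k k<m k-starts → ≡true⇒≢false
        (first-startingBefore∈ k 1≤k (≤-trans (<⇒≤ k<m) m≤r) k-starts (λ y 1≤y y<k → rows-before-m∉ y 1≤y (<-trans y<k k<m)))
        (rows-before-m∉ k 1≤k k<m)

    column-before-i∉ : ∃ λ l → r < l × l < i × J l ≡ false
    column-before-i∉ = proj₂ y , proj₁ (cell-column-bounds (inCell y∈)) , rook-column<i y∈ , col∉ y∈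
      where
      y : ℕ × ℕ
      y = proj₁ rook-m
      y∈ : y ∈ ρ
      y∈ = proj₁ (proj₂ rook-m)

  outerCorner-lastCell-iff : ∀ {i′} → 1 ≤ i′ → suc i′ ≤ r →
    OuterCorner S (suc i′) (suc (r + lam (suc i′))) ⇔ r + lam (suc i′) < r + lam i′
  outerCorner-lastCell-iff {i′} 1≤i′ i≤r = mk⇔ (λ { (_ , _ , _ , _ , _ , L<L′) → L<L′ }) corner
    where
    L : ℕ
    L = r + lam (suc i′)
    corner : L < r + lam i′ → OuterCorner S (suc i′) (suc L)
    corner L<L′ with column-has-cell (m≤m+n (suc r) (lam (suc i′))) (≤-trans L<L′ (+-monoʳ-≤ r (lam-le-c i′ 1≤i′ (<⇒≤ i≤r))))
    ... | k , (1≤k , k≤r , first<L+1 , L+1≤last) =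
      (λ { (_ , _ , _ , L+1≤L) → 1+n≰n L+1≤L }) , lastCell (s≤s z≤n) i≤r ,
      (1≤i′ , <⇒≤ i≤r , ≤-<-trans (+-monoʳ-≤ r (mu-antitone 1≤k k≤i′ (<⇒≤ i≤r))) first<L+1 , L<L′)
      where
      k≤i′ : k ≤ i′
      k≤i′ = ≮⇒≥ λ i′<k → 1+n≰n (≤-trans L+1≤last (+-monoʳ-≤ r (lam-antitone (s≤s z≤n) i′<k k≤r)))

  innerCorner-iff : ∀ {i₀ m m′} → r < i₀ → i₀ ≤ r + c →
    IsFirstRowStartingBefore (suc i₀) m → IsFirstRowStartingBefore (suc (suc i₀)) m′ →
    InnerCorner S (m ∸ 1) i₀ ⇔ m′ < m
  innerCorner-iff {m = zero} _ _ (() , _) _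
  innerCorner-iff {i₀} {suc m₀} {m′} r<i₀ i₀≤n (_ , m≤r , m-starts , m-first) (1≤m′ , _ , m′-starts , m′-first) =
    mk⇔ corner⇒ ⇒corner
    where
    corner⇒ : InnerCorner S m₀ i₀ → m′ < suc m₀
    corner⇒ (_ , _ , right) = s≤s (≮⇒≥ λ m₀<m′ → m′-first m₀ (proj₁ right) m₀<m′ (cell⇒startsBefore right ≤-refl))
    ⇒corner : m′ < suc m₀ → InnerCorner S m₀ i₀
    ⇒corner (s≤s m′≤m₀) = outside , below , right
      where
      1≤m₀ : 1 ≤ m₀
      1≤m₀ = ≤-trans 1≤m′ m′≤m₀
      m₀≤r : m₀ ≤ r
      m₀≤r = <⇒≤ m≤r
      first≡i₀ : r + mu m₀ ≡ i₀
      first≡i₀ = ≤-antisym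
        (≤-trans (+-monoʳ-≤ r (mu-antitone 1≤m′ m′≤m₀ m₀≤r)) (≤-pred (≤-pred m′-starts)))
        (≤-pred (≮⇒≥ (m-first m₀ 1≤m₀ ≤-refl)))
      outside : ¬ InShape S m₀ i₀
      outside (_ , _ , first<i₀ , _) = <-irrefl first≡i₀ first<i₀
      right : InShape S m₀ (suc i₀)
      right = subst (λ x → InShape S m₀ (suc x)) first≡i₀ (firstCell 1≤m₀ m₀≤r)
      below : InShape S (suc m₀) i₀
      below with column-has-cell r<i₀ i₀≤n
      ... | k , cell@(1≤k , k≤r , _ , i₀≤last) =
        s≤s z≤n , m≤r , ≤-pred m-starts , ≤-trans i₀≤last (+-monoʳ-≤ r (lam-antitone (s≤s z≤n) m≤k k≤r))
        where
        m≤k : suc m₀ ≤ k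
        m≤k = ≮⇒≥ λ k<m → m-first k 1≤k k<m (cell⇒startsBefore cell ≤-refl)

  ¬cyclicInterval-alternating : ∀ {B : Subset S} {x₁ x₂ x₃ x₄} →
    1 ≤ x₁ → x₁ < x₂ → x₂ < x₃ → x₃ < x₄ → x₄ ≤ r + c →
    B x₁ ≡ false → B x₂ ≡ true → B x₃ ≡ false → B x₄ ≡ true → ¬ IsCyclicInterval S B
  ¬cyclicInterval-alternating {B} {x₁} {x₂} {x₃} {x₄} 1≤x₁ x₁<x₂ x₂<x₃ x₃<x₄ x₄≤n B₁ B₂ B₃ B₄ (a , b , _ , _ , _ , interval) =
    x₂-inside (to (interval x₂ 1≤x₂ x₂≤n) B₂)
    where
    Inside : ℕ → Set
    Inside x = (a ≤ x × x ≤ b) ⊎ (b < a × (a ≤ x ⊎ x ≤ b))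
    x₃≤n : x₃ ≤ r + c
    x₃≤n = ≤-trans (<⇒≤ x₃<x₄) x₄≤n
    x₂≤n : x₂ ≤ r + c
    x₂≤n = ≤-trans (<⇒≤ x₂<x₃) x₃≤n
    1≤x₂ : 1 ≤ x₂
    1≤x₂ = ≤-trans 1≤x₁ (<⇒≤ x₁<x₂)
    1≤x₃ : 1 ≤ x₃
    1≤x₃ = ≤-trans 1≤x₂ (<⇒≤ x₂<x₃)
    absent : ∀ {x} → 1 ≤ x → x ≤ r + c → B x ≡ false → ¬ Inside x
    absent 1≤x x≤n Bx inside = ≡true⇒≢false (from (interval _ 1≤x x≤n) inside) Bx
    x₂-inside : ¬ Inside x₂
    x₂-inside (inj₂ (b<a , inj₁ a≤x₂)) = absent 1≤x₃ x₃≤n B₃ (inj₂ (b<a , inj₁ (≤-trans a≤x₂ (<⇒≤ x₂<x₃))))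
    x₂-inside (inj₂ (b<a , inj₂ x₂≤b)) =
      absent 1≤x₁ (≤-trans (<⇒≤ x₁<x₂) x₂≤n) B₁ (inj₂ (b<a , inj₂ (≤-trans (<⇒≤ x₁<x₂) x₂≤b)))
    x₂-inside (inj₁ (a≤x₂ , x₂≤b)) with to (interval x₄ (≤-trans 1≤x₃ (<⇒≤ x₃<x₄)) x₄≤n) B₄
    ... | inj₁ (_ , x₄≤b) = absent 1≤x₃ x₃≤n B₃ (inj₁ (≤-trans a≤x₂ (<⇒≤ x₂<x₃) , ≤-trans (<⇒≤ x₃<x₄) x₄≤b))
    ... | inj₂ (b<a , _) = <⇒≱ b<a (≤-trans a≤x₂ x₂≤b)

  IsGrassmannNecklace : (ℕ → ℕ → Bool) → Set
  IsGrassmannNecklace I = ∀ i → 1 ≤ i → i ≤ r + c → IsNecklaceEntry S i (I i)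

  row-corners : ∀ {I} → IsGrassmannNecklace I → ∀ i → 2 ≤ i → i ≤ r →
    (OuterCorner S i (suc (colMax S I i)) ⇔ colMax S I i < colMax S I (i ∸ 1))
    × (OuterCorner S i (suc (colMax S I i)) → ¬ IsCyclicInterval S (I i))
  row-corners {I} necklace (suc i′) (s≤s 1≤i′) i≤r =
    subst₂ Claim (sym Row.colMax-row) (sym Row′.colMax-row) (outerCorner-lastCell-iff 1≤i′ i≤r , ¬cyclic)
    where
    module Row = RowEntry (s≤s z≤n) i≤r (necklace (suc i′) (s≤s z≤n) (≤-trans i≤r (m≤m+n r c)))
    module Row′ = RowEntry 1≤i′ (<⇒≤ i≤r) (necklace i′ 1≤i′ (≤-trans (<⇒≤ i≤r) (m≤m+n r c)))
    Claim : ℕ → ℕ → Set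
    Claim L L′ = (OuterCorner S (suc i′) (suc L) ⇔ L < L′) × (OuterCorner S (suc i′) (suc L) → ¬ IsCyclicInterval S (I (suc i′)))
    ¬cyclic : OuterCorner S (suc i′) (suc Row.L) → ¬ IsCyclicInterval S (I (suc i′))
    ¬cyclic (_ , _ , above) = ¬cyclicInterval-alternating 1≤i′ (n<1+n i′) (≤-<-trans i≤r Row.r<L) (n<1+n Row.L) L+1≤n
      (Row.rows-before-i∉ i′ 1≤i′ (n<1+n i′)) Row.row-i∈ Row.column-L∉ (Row.columns-after-L∈ _ ≤-refl L+1≤n)
      where
      L+1≤n : suc Row.L ≤ r + c
      L+1≤n = proj₂ (cell-column-bounds above)

  rowMin-≤n : ∀ (I : ℕ → ℕ → Bool) {i} → i ≤ r + c → rowMin S I i ≡ minIn (I i) 1 r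
  rowMin-≤n I {i} i≤n with suc (r + c) ≤ᵇ i | ≤ᵇ-reflects-≤ (suc (r + c)) i
  ... | false | _ = refl
  ... | true | ofʸ n<i = contradiction i≤n (<⇒≱ n<i)

  column-corners : ∀ {I} → IsGrassmannNecklace I → ∀ i → r + 2 ≤ i → i ≤ r + c ∸ 1 →
    (InnerCorner S (rowMin S I i ∸ 1) (i ∸ 1) ⇔ rowMin S I (suc i) < rowMin S I i)
    × (InnerCorner S (rowMin S I i ∸ 1) (i ∸ 1) → ¬ IsCyclicInterval S (I i))
  column-corners necklace zero r+2≤0 _ = contradiction (≤-trans (m≤n+m 2 r) r+2≤0) λ ()
  column-corners {I} necklace (suc i₀) r+2≤i i≤n∸1 =
    subst₂ Claim (sym (rowMin-≤n I i≤n)) (sym (rowMin-≤n I i+1≤n))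
      (innerCorner-iff (≤-pred r+2≤i′) (<⇒≤ i≤n) Col.m-first Col′.m-first , ¬cyclic)
    where
    r+2≤i′ : suc (suc r) ≤ suc i₀
    r+2≤i′ = subst (_≤ suc i₀) (+-comm r 2) r+2≤i
    i≤n : suc i₀ ≤ r + c
    i≤n = ≤-trans i≤n∸1 (m∸n≤m (r + c) 1)
    i+1≤n : suc (suc i₀) ≤ r + c
    i+1≤n = subst (_≤ r + c) (+-comm (suc i₀) 1) (m≤o∸n⇒m+n≤o (suc i₀) (≤-trans (s≤s z≤n) i≤n) i≤n∸1)
    module Col = ColumnEntry r+2≤i′ i≤n (necklace (suc i₀) (s≤s z≤n) i≤n)
    module Col′ = ColumnEntry (≤-trans r+2≤i′ (n≤1+n _)) i+1≤n (necklace (suc (suc i₀)) (s≤s z≤n) i+1≤n)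
    Claim : ℕ → ℕ → Set
    Claim m m′ = (InnerCorner S (m ∸ 1) i₀ ⇔ m′ < m) × (InnerCorner S (m ∸ 1) i₀ → ¬ IsCyclicInterval S (I (suc i₀)))
    ¬cyclic : InnerCorner S (Col.m ∸ 1) i₀ → ¬ IsCyclicInterval S (I (suc i₀))
    ¬cyclic (_ , _ , right) with Col.column-before-i∉
    ... | l , r<l , l<i , Jl = ¬cyclicInterval-alternating (proj₁ right) m∸1<m (≤-<-trans Col.m≤r r<l) l<i i≤n
      (Col.rows-before-m∉ _ (proj₁ right) m∸1<m) Col.row-m∈ Jl (Col.columns-from-i∈ (suc i₀) ≤-refl i≤n)
      where
      m∸1<m : Col.m ∸ 1 < Col.m
      m∸1<m = ∸-monoʳ-< (s≤s z≤n) Col.1≤m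

lemma3p28 : (S : SkewShape) (I : ℕ → ℕ → Bool) →
    (∀ i → 1 ≤ i → i ≤ SkewShape.r S + SkewShape.c S → IsNecklaceEntry S i (I i)) →
    (∀ i → 2 ≤ i → i ≤ SkewShape.r S →
       (OuterCorner S i (suc (colMax S I i)) ⇔ colMax S I i < colMax S I (i ∸ 1))
       × (OuterCorner S i (suc (colMax S I i)) → ¬ IsCyclicInterval S (I i)))
    × (∀ i → SkewShape.r S + 2 ≤ i → i ≤ SkewShape.r S + SkewShape.c S ∸ 1 →
       (InnerCorner S (rowMin S I i ∸ 1) (i ∸ 1) ⇔ rowMin S I (suc i) < rowMin S I i)
       × (InnerCorner S (rowMin S I i ∸ 1) (i ∸ 1) → ¬ IsCyclicInterval S (I i)))
lemma3p28 S I necklace = row-corners S necklace , column-corners S necklace
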